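{- Let $G$ be a snake graph with hexagonal tiles, and let $X$ be one of its hexagonal tiles, with distinguished edges $A,B,C,D$ as defined in the context. Then every perfect matching of $G$ contains exactly one of the four edges $A,B,C,D$.
   Context: A tile is a unit square of the lattice $\mathbb{Z}^2$, viewed as a graph with four vertices and four edges (its south, east, north and west edges). A snake graph is a graph obtained as the union of tiles $G_1,\dots,G_d$ ($d\ge 1$) in the plane such that for each $1\le i<d$ the tile $G_{i+1}$ is the translate of $G_i$ by $(0,1)$ or by $(1,0)$ (so $G_i$ and $G_{i+1}$ share exactly the north edge or the east edge of $G_i$), with no other identifications of vertices or edges. A snake graph with hexagonal tiles is obtained from a snake graph $G_1,\dots,G_d$ by choosing a collection of pairwise disjoint pairs $\{j,j+1\}$ of consecutive indices and, for each chosen pair, adding one new edge $C$ joining the northwest corner and the southeast corner of the $2\times 1$ (or $1\times 2$) rectangle $G_j\cup G_{j+1}$. For such a pair, the subgraph $X=G_j\cup G_{j+1}\cup\{C\}$ is called a hexagonal tile; its distinguished edges are: $B$, the edge shared by $G_j$ and $G_{j+1}$; $C$, the added edge; and $A$ and $D$, the two edges of $G_j\cup G_{j+1}$ each of which joins an endpoint of $C$ to an endpoint of $B$ (each endpoint of $C$ is adjacent in $G_j\cup G_{j+1}$ to exactly one endpoint of $B$). A perfect matching of a graph is a set of edges such that every vertex lies on exactly one of them. -}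

module Defs where

open import Data.Nat using (ℕ; zero; suc; _+_)
open import Data.Bool using (Bool; true; false)
open import Data.Fin using (Fin; zero; suc; toℕ; inject₁)
open import Data.Vec using (Vec; []; _∷_; lookup)
open import Data.Product using (_×_; _,_; Σ; ∃)
open import Data.Sum using (_⊎_)
open import Relation.Binary.PropositionalEquality using (_≡_)

-- Lattice points of Z^2 (snake graphs only move north/east from the
-- origin, so ℕ × ℕ suffices).
Point : Set
Point = ℕ × ℕ

data Dir : Set where
  N E : Dir

move : Dir → Point → Point
move N (x , y) = (x , suc y)
move E (x , y) = (suc x , y)

-- A snake graph with n+1 tiles G_0..G_n is given by ds : Vec Dir n.
-- posFrom p ds i = south-west corner of tile i when tile 0 sits at p.
posFrom : ∀ {n} → Point → Vec Dir n → Fin (suc n) → Point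
posFrom p ds zero = p
posFrom p (d ∷ ds) (suc i) = posFrom (move d p) ds i

pos : ∀ {n} → Vec Dir n → Fin (suc n) → Point
pos = posFrom (0 , 0)

-- Edges: horizontal unit segment (x,y)-(x+1,y), vertical unit segment
-- (x,y)-(x,y+1), and an added (non-lattice) edge joining two points.
data Edge : Set where
  hor  : ℕ → ℕ → Edge
  ver  : ℕ → ℕ → Edge
  diag : Point → Point → Edge

_∈ₑ_ : Point → Edge → Set
v ∈ₑ hor x y    = (v ≡ (x , y)) ⊎ (v ≡ (suc x , y))
v ∈ₑ ver x y    = (v ≡ (x , y)) ⊎ (v ≡ (x , suc y))
v ∈ₑ diag p q   = (v ≡ p) ⊎ (v ≡ q)

TileEdge : Point → Edge → Set
TileEdge (x , y) e =
  (e ≡ hor x y) ⊎ (e ≡ ver (suc x) y) ⊎ (e ≡ hor x (suc y)) ⊎ (e ≡ ver x y)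

TileVertex : Point → Point → Set
TileVertex (x , y) v =
  (v ≡ (x , y)) ⊎ (v ≡ (suc x , y)) ⊎ (v ≡ (suc x , suc y)) ⊎ (v ≡ (x , suc y))

-- Hexagonal tile data for the pair {j, j+1} (j : Fin n, tiles inject₁ j and suc j).
-- c = SW corner of G_j, d = direction from G_j to G_{j+1}.
-- Rectangle G_j ∪ G_{j+1}: for E it is [x,x+2]×[y,y+1], for N it is [x,x+1]×[y,y+2].

-- C : joins the NW corner and SE corner of the rectangle.
edgeC : Dir → Point → Edge
edgeC E (x , y) = diag (x , suc y) (suc (suc x) , y)
edgeC N (x , y) = diag (x , suc (suc y)) (suc x , y)

-- B : the edge shared by G_j and G_{j+1}.
edgeB : Dir → Point → Edge
edgeB E (x , y) = ver (suc x) y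
edgeB N (x , y) = hor x (suc y)

-- A : edge of G_j ∪ G_{j+1} joining the NW endpoint of C to an endpoint of B.
edgeA : Dir → Point → Edge
edgeA E (x , y) = hor x (suc y)
edgeA N (x , y) = ver x (suc y)

-- D : edge of G_j ∪ G_{j+1} joining the SE endpoint of C to an endpoint of B.
edgeD : Dir → Point → Edge
edgeD E (x , y) = hor (suc x) y
edgeD N (x , y) = ver (suc x) y

module _ {n : ℕ} (ds : Vec Dir n) (hex : Fin n → Bool) where

  hexCorner : Fin n → Point
  hexCorner j = pos ds (inject₁ j)

  hexDir : Fin n → Dir
  hexDir j = lookup ds j

  PairsDisjoint : Set
  PairsDisjoint = ∀ (j k : Fin n) → toℕ k ≡ suc (toℕ j) → hex j ≡ true → hex k ≡ false

  IsVertex : Point → Set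
  IsVertex v = ∃ λ (i : Fin (suc n)) → TileVertex (pos ds i) v

  IsEdge : Edge → Set
  IsEdge e = (∃ λ (i : Fin (suc n)) → TileEdge (pos ds i) e)
           ⊎ (∃ λ (j : Fin n) → (hex j ≡ true) × (e ≡ edgeC (hexDir j) (hexCorner j)))

  IsPerfectMatching : (Edge → Bool) → Set
  IsPerfectMatching M =
    (∀ e → M e ≡ true → IsEdge e) ×
    (∀ v → IsVertex v →
       Σ Edge λ e → (M e ≡ true) × (v ∈ₑ e) ×
         (∀ e′ → M e′ ≡ true → v ∈ₑ e′ → e′ ≡ e))

b2n : Bool → ℕ
b2n true = 1
b2n false = 0

ExactlyOneOf4 : Bool → Bool → Bool → Bool → Set
ExactlyOneOf4 a b c d = b2n a + b2n b + b2n c + b2n d ≡ 1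

-- Give a lattice point (x, y) the level x + y. Every edge of the graph, the added
-- diagonals included, joins a vertex of some level ℓ to one of level ℓ + 1; the only
-- vertex of level 0 is the origin, and the vertices of level s + 1 are the NW and SE
-- corners of tile G_s. Induction on s shows that a perfect matching contains exactly
-- one edge between levels s and s + 1: of the two vertices of level s + 1, one is
-- covered by the unique edge coming from below, so the other must be matched upwards,
-- and no other edge can cross. For the hexagonal tile on G_j ∪ G_{j+1} the edges
-- between levels j + 1 and j + 2 are precisely A, B, C and D.
module Submission where

open import Defs
open import Data.Nat using (ℕ; zero; suc; _+_; _≤_; _<_; s≤s)
open import Data.Nat.Properties using (+-suc; suc-injective; 1+n≢n; <⇒≤)
open import Data.Bool using (Bool; true; false)
open import Data.Fin using (Fin; zero; suc; toℕ; inject₁; fromℕ<)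
open import Data.Fin.Properties using (toℕ-inject₁; toℕ-fromℕ<; toℕ<n)
open import Data.Vec using (Vec; []; _∷_; lookup)
open import Data.Product using (_×_; _,_; ∃; ∃₂; proj₁; proj₂)
open import Data.Sum using (_⊎_; inj₁; inj₂; [_,_]′; swap)
open import Data.Empty using (⊥-elim)
open import Relation.Binary.PropositionalEquality

OneOf4 : {X : Set} → X → X → X → X → X → Set
OneOf4 a b c d x = x ≡ a ⊎ x ≡ b ⊎ x ≡ c ⊎ x ≡ d

Distinct4 : {X : Set} → X → X → X → X → Set
Distinct4 a b c d = a ≢ b × a ≢ c × a ≢ d × b ≢ c × b ≢ d × c ≢ d

exactlyOneOf4 : ∀ {X : Set} (f : X → Bool) {a b c d x : X} →
  Distinct4 a b c d → OneOf4 a b c d x → f x ≡ true →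
  (∀ {y} → OneOf4 a b c d y → f y ≡ true → y ≡ x) →
  ExactlyOneOf4 (f a) (f b) (f c) (f d)
exactlyOneOf4 f {a} {b} {c} {d} {x} (a≢b , a≢c , a≢d , b≢c , b≢d , c≢d) x∈ fx only =
  count (f a) (f b) (f c) (f d) refl refl refl refl
  where
  same : ∀ {y z} → OneOf4 a b c d y → OneOf4 a b c d z → f y ≡ true → f z ≡ true → y ≡ z
  same y∈ z∈ fy fz = trans (only y∈ fy) (sym (only z∈ fz))

  unmatched : ∀ {y} → f y ≡ false → x ≢ y
  unmatched fy refl with trans (sym fx) fy
  ... | ()

  a∈ = inj₁ refl
  b∈ = inj₂ (inj₁ refl)
  c∈ = inj₂ (inj₂ (inj₁ refl))
  d∈ = inj₂ (inj₂ (inj₂ refl))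

  count : ∀ p q r t → f a ≡ p → f b ≡ q → f c ≡ r → f d ≡ t → ExactlyOneOf4 p q r t
  count true  true  _     _     fa fb _  _  = ⊥-elim (a≢b (same a∈ b∈ fa fb))
  count true  false true  _     fa _  fc _  = ⊥-elim (a≢c (same a∈ c∈ fa fc))
  count true  false false true  fa _  _  fd = ⊥-elim (a≢d (same a∈ d∈ fa fd))
  count true  false false false _  _  _  _  = refl
  count false true  true  _     _  fb fc _  = ⊥-elim (b≢c (same b∈ c∈ fb fc))
  count false true  false true  _  fb _  fd = ⊥-elim (b≢d (same b∈ d∈ fb fd))
  count false true  false false _  _  _  _  = refl
  count false false true  true  _  _  fc fd = ⊥-elim (c≢d (same c∈ d∈ fc fd))
  count false false true  false _  _  _  _  = refl
  count false false false true  _  _  _  _  = refl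
  count false false false false fa fb fc fd =
    ⊥-elim ([ unmatched fa , [ unmatched fb , [ unmatched fc , unmatched fd ]′ ]′ ]′ x∈)

lev : Point → ℕ
lev (x , y) = x + y

lev≡0 : ∀ {v} → lev v ≡ 0 → v ≡ (0 , 0)
lev≡0 {zero , zero} refl = refl

NW SE NE : Point → Point
NW (x , y) = (x , suc y)
SE (x , y) = (suc x , y)
NE (x , y) = (suc x , suc y)

data Step : Point → Point → Edge → Set where
  east   : ∀ {x y} → Step (x , y) (suc x , y) (hor x y)
  north  : ∀ {x y} → Step (x , y) (x , suc y) (ver x y)
  diag-E : ∀ {x y} → Step (x , suc y) (suc (suc x) , y) (edgeC E (x , y))
  diag-N : ∀ {x y} → Step (suc x , y) (x , suc (suc y)) (edgeC N (x , y))

step-lev : ∀ {u w e} → Step u w e → lev w ≡ suc (lev u)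
step-lev east = refl
step-lev (north {x} {y}) = +-suc x y
step-lev (diag-E {x} {y}) = cong suc (sym (+-suc x y))
step-lev (diag-N {x} {y}) = trans (+-suc x (suc y)) (cong suc (+-suc x y))

step-source : ∀ {u w e} → Step u w e → u ∈ₑ e
step-source east = inj₁ refl
step-source north = inj₁ refl
step-source diag-E = inj₁ refl
step-source diag-N = inj₂ refl

step-target : ∀ {u w e} → Step u w e → w ∈ₑ e
step-target east = inj₂ refl
step-target north = inj₂ refl
step-target diag-E = inj₂ refl
step-target diag-N = inj₁ refl

step-ends : ∀ {u w e v} → Step u w e → v ∈ₑ e → v ≡ u ⊎ v ≡ w
step-ends east v∈e = v∈e
step-ends north v∈e = v∈e
step-ends diag-E v∈e = v∈e
step-ends diag-N v∈e = swap v∈e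

step-unique-ends : ∀ {u w u′ w′ e} → Step u w e → Step u′ w′ e → u ≡ u′ × w ≡ w′
step-unique-ends east east = refl , refl
step-unique-ends north north = refl , refl
step-unique-ends diag-E diag-E = refl , refl
step-unique-ends diag-N diag-N = refl , refl

Crosses : ℕ → Edge → Set
Crosses s e = ∃₂ λ u w → Step u w e × lev u ≡ s

tileEdge-step : ∀ c {e} → TileEdge c e → ∃₂ λ u w → Step u w e
tileEdge-step c (inj₁ refl) = _ , _ , east
tileEdge-step c (inj₂ (inj₁ refl)) = _ , _ , north
tileEdge-step c (inj₂ (inj₂ (inj₁ refl))) = _ , _ , east
tileEdge-step c (inj₂ (inj₂ (inj₂ refl))) = _ , _ , north

edgeC-step : ∀ d c → ∃₂ λ u w → Step u w (edgeC d c)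
edgeC-step E c = _ , _ , diag-E
edgeC-step N c = _ , _ , diag-N

tileEdge-vertex : ∀ c {e v} → TileEdge c e → v ∈ₑ e → TileVertex c v
tileEdge-vertex c (inj₁ refl) (inj₁ refl) = inj₁ refl
tileEdge-vertex c (inj₁ refl) (inj₂ refl) = inj₂ (inj₁ refl)
tileEdge-vertex c (inj₂ (inj₁ refl)) (inj₁ refl) = inj₂ (inj₁ refl)
tileEdge-vertex c (inj₂ (inj₁ refl)) (inj₂ refl) = inj₂ (inj₂ (inj₁ refl))
tileEdge-vertex c (inj₂ (inj₂ (inj₁ refl))) (inj₁ refl) = inj₂ (inj₂ (inj₂ refl))
tileEdge-vertex c (inj₂ (inj₂ (inj₁ refl))) (inj₂ refl) = inj₂ (inj₂ (inj₁ refl))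
tileEdge-vertex c (inj₂ (inj₂ (inj₂ refl))) (inj₁ refl) = inj₁ refl
tileEdge-vertex c (inj₂ (inj₂ (inj₂ refl))) (inj₂ refl) = inj₂ (inj₂ (inj₂ refl))

Rim : Point → Point → Set
Rim c v = v ≡ NW c ⊎ v ≡ SE c

rim-lev : ∀ c {v} → Rim c v → lev v ≡ suc (lev c)
rim-lev (x , y) (inj₁ refl) = +-suc x y
rim-lev (x , y) (inj₂ refl) = refl

move-rim : ∀ d c → Rim c (move d c)
move-rim N c = inj₁ refl
move-rim E c = inj₂ refl

NE-rim : ∀ d c → Rim (move d c) (NE c)
NE-rim N c = inj₂ refl
NE-rim E c = inj₁ refl

rim-tileVertex : ∀ c {v} → Rim c v → TileVertex c v
rim-tileVertex c (inj₁ refl) = inj₂ (inj₂ (inj₂ refl))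
rim-tileVertex c (inj₂ refl) = inj₂ (inj₁ refl)

rim-other : ∀ {c w} → Rim c w →
  ∃ λ b → Rim c b × b ≢ w × (∀ {z} → Rim c z → z ≡ w ⊎ z ≡ b)
rim-other (inj₁ refl) = _ , inj₂ refl , (λ ()) , (λ z∈ → z∈)
rim-other (inj₂ refl) = _ , inj₁ refl , (λ ()) , swap

tileVertex-cases : ∀ c {v} → TileVertex c v → v ≡ c ⊎ Rim c v ⊎ v ≡ NE c
tileVertex-cases c (inj₁ v≡c) = inj₁ v≡c
tileVertex-cases c (inj₂ (inj₁ v≡SE)) = inj₂ (inj₁ (inj₂ v≡SE))
tileVertex-cases c (inj₂ (inj₂ (inj₁ v≡NE))) = inj₂ (inj₂ v≡NE)
tileVertex-cases c (inj₂ (inj₂ (inj₂ v≡NW))) = inj₂ (inj₁ (inj₁ v≡NW))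

edgeC-rim : ∀ d c {v} → v ∈ₑ edgeC d c → Rim c v ⊎ Rim (move d c) v
edgeC-rim E c (inj₁ refl) = inj₁ (inj₁ refl)
edgeC-rim E c (inj₂ refl) = inj₂ (inj₂ refl)
edgeC-rim N c (inj₁ refl) = inj₂ (inj₁ refl)
edgeC-rim N c (inj₂ refl) = inj₁ (inj₂ refl)

HexEdge : Dir → Point → Edge → Set
HexEdge d c = OneOf4 (edgeA d c) (edgeB d c) (edgeC d c) (edgeD d c)

hexEdge-distinct : ∀ d c → Distinct4 (edgeA d c) (edgeB d c) (edgeC d c) (edgeD d c)
hexEdge-distinct E c = (λ ()) , (λ ()) , (λ ()) , (λ ()) , (λ ()) , (λ ())
hexEdge-distinct N c = (λ ()) , (λ ()) , (λ ()) , (λ ()) , (λ ()) , (λ ())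

hexEdge-crosses : ∀ d c {e} → HexEdge d c e → Crosses (suc (lev c)) e
hexEdge-crosses E (x , y) (inj₁ refl) = _ , _ , east , +-suc x y
hexEdge-crosses E (x , y) (inj₂ (inj₁ refl)) = _ , _ , north , refl
hexEdge-crosses E (x , y) (inj₂ (inj₂ (inj₁ refl))) = _ , _ , diag-E , +-suc x y
hexEdge-crosses E (x , y) (inj₂ (inj₂ (inj₂ refl))) = _ , _ , east , refl
hexEdge-crosses N (x , y) (inj₁ refl) = _ , _ , north , +-suc x y
hexEdge-crosses N (x , y) (inj₂ (inj₁ refl)) = _ , _ , east , +-suc x y
hexEdge-crosses N (x , y) (inj₂ (inj₂ (inj₁ refl))) = _ , _ , diag-N , refl
hexEdge-crosses N (x , y) (inj₂ (inj₂ (inj₂ refl))) = _ , _ , north , refl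

rim-step-hexEdge : ∀ d c {u w e} → Rim c u → Rim (move d c) w → Step u w e → HexEdge d c e
rim-step-hexEdge E c (inj₁ refl) (inj₁ refl) east = inj₁ refl
rim-step-hexEdge E c (inj₁ refl) (inj₂ refl) diag-E = inj₂ (inj₂ (inj₁ refl))
rim-step-hexEdge E c (inj₂ refl) (inj₁ refl) north = inj₂ (inj₁ refl)
rim-step-hexEdge E c (inj₂ refl) (inj₂ refl) east = inj₂ (inj₂ (inj₂ refl))
rim-step-hexEdge N c (inj₁ refl) (inj₁ refl) north = inj₁ refl
rim-step-hexEdge N c (inj₁ refl) (inj₂ refl) east = inj₂ (inj₁ refl)
rim-step-hexEdge N c (inj₂ refl) (inj₁ refl) diag-N = inj₂ (inj₂ (inj₁ refl))
rim-step-hexEdge N c (inj₂ refl) (inj₂ refl) north = inj₂ (inj₂ (inj₂ refl))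

-- Beyond the last tile the direction is an arbitrary E; only indices k < n matter.
dirAt : ∀ {n} → Vec Dir n → ℕ → Dir
dirAt [] k = E
dirAt (d ∷ ds) zero = d
dirAt (d ∷ ds) (suc k) = dirAt ds k

lookup≡dirAt : ∀ {n} (ds : Vec Dir n) (j : Fin n) → lookup ds j ≡ dirAt ds (toℕ j)
lookup≡dirAt (d ∷ ds) zero = refl
lookup≡dirAt (d ∷ ds) (suc j) = lookup≡dirAt ds j

cornerFrom : ∀ {n} → Point → Vec Dir n → ℕ → Point
cornerFrom p ds zero = p
cornerFrom p ds (suc k) = move (dirAt ds k) (cornerFrom p ds k)

cornerFrom-∷ : ∀ {n} p d (ds : Vec Dir n) k →
  cornerFrom p (d ∷ ds) (suc k) ≡ cornerFrom (move d p) ds k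
cornerFrom-∷ p d ds zero = refl
cornerFrom-∷ p d ds (suc k) = cong (move (dirAt ds k)) (cornerFrom-∷ p d ds k)

posFrom≡cornerFrom : ∀ {n} p (ds : Vec Dir n) i → posFrom p ds i ≡ cornerFrom p ds (toℕ i)
posFrom≡cornerFrom p ds zero = refl
posFrom≡cornerFrom p (d ∷ ds) (suc i) =
  trans (posFrom≡cornerFrom (move d p) ds i) (sym (cornerFrom-∷ p d ds (toℕ i)))

module SnakeGraph {n : ℕ} (ds : Vec Dir n) (hex : Fin n → Bool) where

  corner : ℕ → Point
  corner = cornerFrom (0 , 0) ds

  lev-corner : ∀ k → lev (corner k) ≡ k
  lev-corner zero = refl
  lev-corner (suc k) =
    trans (rim-lev (corner k) (move-rim (dirAt ds k) (corner k))) (cong suc (lev-corner k))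

  rung-lev : ∀ {s v} → Rim (corner s) v → lev v ≡ suc s
  rung-lev {s} r = trans (rim-lev (corner s) r) (cong suc (lev-corner s))

  pos≡corner : ∀ i → pos ds i ≡ corner (toℕ i)
  pos≡corner = posFrom≡cornerFrom (0 , 0) ds

  hexCorner≡corner : ∀ j → hexCorner ds hex j ≡ corner (toℕ j)
  hexCorner≡corner j = trans (pos≡corner (inject₁ j)) (cong corner (toℕ-inject₁ j))

  OnLadder : Point → Set
  OnLadder v = v ≡ (0 , 0) ⊎ ∃ λ s → Rim (corner s) v

  corner-ladder : ∀ k → OnLadder (corner k)
  corner-ladder zero = inj₁ refl
  corner-ladder (suc k) = inj₂ (k , move-rim (dirAt ds k) (corner k))

  tileVertex-ladder : ∀ k {v} → TileVertex (corner k) v → OnLadder v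
  tileVertex-ladder k tv with tileVertex-cases (corner k) tv
  ... | inj₁ refl = corner-ladder k
  ... | inj₂ (inj₁ r) = inj₂ (k , r)
  ... | inj₂ (inj₂ refl) = inj₂ (suc k , NE-rim (dirAt ds k) (corner k))

  isVertex-ladder : ∀ {v} → IsVertex ds hex v → OnLadder v
  isVertex-ladder (i , tv) =
    tileVertex-ladder (toℕ i) (subst (λ c → TileVertex c _) (pos≡corner i) tv)

  isEdge-ladder : ∀ {e v} → IsEdge ds hex e → v ∈ₑ e → OnLadder v
  isEdge-ladder (inj₁ (i , te)) v∈e = isVertex-ladder (i , tileEdge-vertex (pos ds i) te v∈e)
  isEdge-ladder {v = v} (inj₂ (j , _ , refl)) v∈C =
    [ (λ r → inj₂ (k , r)) , (λ r → inj₂ (suc k , r)) ]′ (edgeC-rim (dirAt ds k) (corner k) v∈C′)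
    where
    k = toℕ j
    v∈C′ : v ∈ₑ edgeC (dirAt ds k) (corner k)
    v∈C′ = subst₂ (λ d c → v ∈ₑ edgeC d c) (lookup≡dirAt ds j) (hexCorner≡corner j) v∈C

  ladder-rim : ∀ {v s} → OnLadder v → lev v ≡ suc s → Rim (corner s) v
  ladder-rim (inj₁ refl) ()
  ladder-rim {v} (inj₂ (t , r)) lv =
    subst (λ t → Rim (corner t) v) (suc-injective (trans (sym (rung-lev {t} r)) lv)) r

  endpoint-rim : ∀ {e v s} → IsEdge ds hex e → v ∈ₑ e → lev v ≡ suc s → Rim (corner s) v
  endpoint-rim e v∈e = ladder-rim (isEdge-ladder e v∈e)

  rim-isVertex : ∀ {s v} → s ≤ n → Rim (corner s) v → IsVertex ds hex v
  rim-isVertex {s} s≤n r =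
    i , subst (λ c → TileVertex c _) (sym pos-i) (rim-tileVertex (corner s) r)
    where
    i = fromℕ< (s≤s s≤n)
    pos-i : pos ds i ≡ corner s
    pos-i = trans (pos≡corner i) (cong corner (toℕ-fromℕ< (s≤s s≤n)))

  isEdge-step : ∀ {e} → IsEdge ds hex e → ∃₂ λ u w → Step u w e
  isEdge-step (inj₁ (i , te)) = tileEdge-step (pos ds i) te
  isEdge-step (inj₂ (j , _ , refl)) = edgeC-step _ _

  origin-isVertex : IsVertex ds hex (0 , 0)
  origin-isVertex = zero , inj₁ refl

  module PerfectMatching (M : Edge → Bool) (pm : IsPerfectMatching ds hex M) where

    matched-isEdge : ∀ {e} → M e ≡ true → IsEdge ds hex e
    matched-isEdge = proj₁ pm _

    mate : ∀ {v} → IsVertex ds hex v → ∃ λ e → M e ≡ true × v ∈ₑ e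
    mate vv with proj₂ pm _ vv
    ... | e , Me , v∈e , _ = e , Me , v∈e

    matched-unique : ∀ {v e e′} → IsVertex ds hex v →
      M e ≡ true → v ∈ₑ e → M e′ ≡ true → v ∈ₑ e′ → e ≡ e′
    matched-unique vv Me v∈e Me′ v∈e′ with proj₂ pm _ vv
    ... | _ , _ , _ , only = trans (only _ Me v∈e) (sym (only _ Me′ v∈e′))

    UniqueCrossing : ℕ → Set
    UniqueCrossing s =
      ∃ λ e → M e ≡ true × Crosses s e × (∀ {e′} → M e′ ≡ true → Crosses s e′ → e′ ≡ e)

    uniqueCrossing-zero : UniqueCrossing 0
    uniqueCrossing-zero with mate origin-isVertex
    ... | e , Me , o∈e with isEdge-step (matched-isEdge Me)
    ...   | u , w , st with step-ends st o∈e | step-lev st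
    ...     | inj₂ refl | ()
    ...     | inj₁ refl | _ = e , Me , (_ , w , st , refl) , only
      where
      only : ∀ {e′} → M e′ ≡ true → Crosses 0 e′ → e′ ≡ e
      only Me′ (_ , _ , st′ , lz) =
        matched-unique origin-isVertex Me′ (subst (_∈ₑ _) (lev≡0 lz) (step-source st′)) Me o∈e

    uniqueCrossing-suc : ∀ {s} → s ≤ n → UniqueCrossing s → UniqueCrossing (suc s)
    uniqueCrossing-suc {s} s≤n (e₀ , Me₀ , (u , w , st₀ , lu) , only₀)
      with endpoint-rim (matched-isEdge Me₀) (step-target st₀) (trans (step-lev st₀) (cong suc lu))
    ... | w-rim with rim-other w-rim
    ... | b , b-rim , b≢w , w⊎b with mate (rim-isVertex s≤n b-rim)
    ... | f , Mf , b∈f with isEdge-step (matched-isEdge Mf)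
    ... | u′ , w′ , st with step-ends st b∈f
    -- Were b matched downwards, its edge would cross s, so it would be e₀, whose top is w.
    ... | inj₂ refl = ⊥-elim (b≢w (proj₂ (step-unique-ends st-e₀ st₀)))
      where
      f-crosses : Crosses s f
      f-crosses = u′ , b , st , suc-injective (trans (sym (step-lev st)) (rung-lev b-rim))
      st-e₀ : Step u′ b e₀
      st-e₀ = subst (Step u′ b) (only₀ Mf f-crosses) st
    ... | inj₁ refl = f , Mf , (b , w′ , st , rung-lev b-rim) , only
      where
      only : ∀ {g} → M g ≡ true → Crosses (suc s) g → g ≡ f
      only Mg (z , z′ , st-g , lz) with w⊎b (endpoint-rim (matched-isEdge Mg) (step-source st-g) lz)
      ... | inj₂ refl = matched-unique (rim-isVertex s≤n b-rim) Mg (step-source st-g) Mf b∈f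
      ... | inj₁ refl = ⊥-elim (1+n≢n (trans (sym lz) (trans (cong lev w≡u) lu)))
        where
        g≡e₀ = matched-unique (rim-isVertex s≤n w-rim) Mg (step-source st-g) Me₀ (step-target st₀)
        w≡u = proj₁ (step-unique-ends (subst (Step w z′) g≡e₀ st-g) st₀)

    uniqueCrossing : ∀ {s} → s ≤ n → UniqueCrossing s
    uniqueCrossing {zero} _ = uniqueCrossing-zero
    uniqueCrossing {suc s} s<n = uniqueCrossing-suc (<⇒≤ s<n) (uniqueCrossing (<⇒≤ s<n))

    exactlyOne-hexEdges : ∀ {k} → k < n →
      let d = dirAt ds k; c = corner k in
      ExactlyOneOf4 (M (edgeA d c)) (M (edgeB d c)) (M (edgeC d c)) (M (edgeD d c))
    exactlyOne-hexEdges {k} k<n with uniqueCrossing k<n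
    ... | e₀ , Me₀ , (u , w , st , lu) , only =
      exactlyOneOf4 M (hexEdge-distinct d c) e₀-hex Me₀ (λ hx Mx → only Mx (crosses hx))
      where
      d = dirAt ds k
      c = corner k
      edge₀ = matched-isEdge Me₀
      e₀-hex : HexEdge d c e₀
      e₀-hex = rim-step-hexEdge d c (endpoint-rim edge₀ (step-source st) lu)
                 (endpoint-rim edge₀ (step-target st) (trans (step-lev st) (cong suc lu))) st
      crosses : ∀ {x} → HexEdge d c x → Crosses (suc k) x
      crosses hx = subst (λ l → Crosses (suc l) _) (lev-corner k) (hexEdge-crosses d c hx)

-- The four edges cross between levels k + 1 and k + 2 for every k < n, whether or not
-- C was added.
lemma5p4 : (n : ℕ) (ds : Vec Dir n) (hex : Fin n → Bool) →
    PairsDisjoint ds hex →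
    (j : Fin n) → hex j ≡ true →
    (M : Edge → Bool) → IsPerfectMatching ds hex M →
    ExactlyOneOf4 (M (edgeA (hexDir ds hex j) (hexCorner ds hex j)))
                  (M (edgeB (hexDir ds hex j) (hexCorner ds hex j)))
                  (M (edgeC (hexDir ds hex j) (hexCorner ds hex j)))
                  (M (edgeD (hexDir ds hex j) (hexCorner ds hex j)))
lemma5p4 n ds hex _ j _ M pm
  rewrite lookup≡dirAt ds j | SnakeGraph.hexCorner≡corner ds hex j = exactlyOne-hexEdges (toℕ<n j)
  where
  open SnakeGraph ds hex
  open PerfectMatching M pm
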